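{- If $G$ and $H$ are Left dead-ends, then $b(G+H)=b(G)+b(H)$.
   Context: Games are finite partizan games; the formal birthday $\tilde b(G)$ is the height of the game tree. Sum $G+H=\{G^L+H,G+H^L\mid G^R+H,G+H^R\}$. Misère outcomes: $o^L(G)=\mathscr{L}$ iff $G$ has no Left option or some $o^R(G^L)=\mathscr{L}$ (else $\mathscr{R}$); $o^R(G)=\mathscr{R}$ iff $G$ has no Right option or some $o^L(G^R)=\mathscr{R}$ (else $\mathscr{L}$); $o(G)$ is the pair $(o^L(G),o^R(G))$. $G\equiv_{\mathcal{M}}H$ means $o(G+X)=o(H+X)$ for every game $X$ (for Left dead-ends this coincides with equivalence modulo any universe). A Left dead-end is a game all of whose subpositions have no Left option; sums of Left dead-ends are Left dead-ends. For a Left dead-end $G$, its birthday is $b(G)=\min\{\tilde b(K): K \text{ a Left dead-end with } K\equiv_{\mathcal{M}}G\}$. -}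

module Defs where

open import Data.Nat using (ℕ; zero; suc; _⊔_; _≤_)
open import Data.Fin using (Fin; splitAt)
open import Data.Sum using ([_,_]′)
open import Data.Product using (Σ; _×_; _,_)
open import Data.Empty using (⊥)
open import Data.Bool using (Bool; true; false; _∨_; if_then_else_)
open import Relation.Binary.PropositionalEquality using (_≡_)

data Game : Set where
  mk : (m : ℕ) → (Fin m → Game) → (n : ℕ) → (Fin n → Game) → Game

anyFin : (n : ℕ) → (Fin n → Bool) → Bool
anyFin zero    f = false
anyFin (suc n) f = f Fin.zero ∨ anyFin n (λ i → f (Fin.suc i))

maxFin : (n : ℕ) → (Fin n → ℕ) → ℕ
maxFin zero    f = 0
maxFin (suc n) f = f Fin.zero ⊔ maxFin n (λ i → f (Fin.suc i))

formalBirthday : Game → ℕ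
formalBirthday (mk zero GL zero GR) = 0
formalBirthday (mk (suc m) GL n GR) =
  suc (maxFin (suc m) (λ i → formalBirthday (GL i)) ⊔ maxFin n (λ j → formalBirthday (GR j)))
formalBirthday (mk zero GL (suc n) GR) =
  suc (maxFin (suc n) (λ j → formalBirthday (GR j)))

-- disjunctive sum G + H = {G^L+H, G+H^L | G^R+H, G+H^R}
infixl 6 _+ᴳ_
_+ᴳ_ : Game → Game → Game
mk m GL n GR +ᴳ mk m' HL n' HR =
  mk (m Data.Nat.+ m')
     (λ k → [ (λ i → GL i +ᴳ mk m' HL n' HR) , (λ i → mk m GL n GR +ᴳ HL i) ]′ (splitAt m k))
     (n Data.Nat.+ n')
     (λ k → [ (λ j → GR j +ᴳ mk m' HL n' HR) , (λ j → mk m GL n GR +ᴳ HR j) ]′ (splitAt n k))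

data Out : Set where
  𝓛 𝓡 : Out

isL : Out → Bool
isL 𝓛 = true
isL 𝓡 = false

isR : Out → Bool
isR 𝓛 = false
isR 𝓡 = true

mutual
  oL : Game → Out
  oL (mk zero GL n GR) = 𝓛
  oL (mk (suc m) GL n GR) =
    if anyFin (suc m) (λ i → isL (oR (GL i))) then 𝓛 else 𝓡

  oR : Game → Out
  oR (mk m GL zero GR) = 𝓡
  oR (mk m GL (suc n) GR) =
    if anyFin (suc n) (λ j → isR (oL (GR j))) then 𝓡 else 𝓛

outcome : Game → Out × Out
outcome G = oL G , oR G

-- misère equivalence (over the full universe of games)
_≡ᴹ_ : Game → Game → Set
G ≡ᴹ H = (X : Game) → outcome (G +ᴳ X) ≡ outcome (H +ᴳ X)

IsLeftDeadEnd : Game → Set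
IsLeftDeadEnd (mk zero GL n GR) = (j : Fin n) → IsLeftDeadEnd (GR j)
IsLeftDeadEnd (mk (suc m) GL n GR) = ⊥

IsBirthday : Game → ℕ → Set
IsBirthday G k =
  Σ Game (λ K → IsLeftDeadEnd K × K ≡ᴹ G × formalBirthday K ≡ k)
  × ((K : Game) → IsLeftDeadEnd K → K ≡ᴹ G → k ≤ formalBirthday K)

-- For Left dead-ends the formal birthday b̃ is already the birthday. Indeed, for dead-ends A
-- and B, either each Right option of B is dominated in b̃ by some Right option of A, giving
-- b̃ B ≤ b̃ A, or (by induction) some Right option B′ of B is distinguished from every Right
-- option Aᵢ of A by a game Zᵢ. Then Y = {b̃ B′, Z₁, …, Zₖ | 0} separates A from B with Right
-- moving first: in B + Y Right moves to B′ + Y, where every Left move loses because the integer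
-- b̃ B′ outlasts B′; in A + Y Left answers Aᵢ + Y with Aᵢ + Zᵢ, and A + 0 leaves Left without
-- a move. Additivity of b̃ on dead-ends is an induction over the Right options G^R + H, G + H^R.

module Submission where

open import Defs
open import Data.Nat using (ℕ; zero; suc; _+_; _≤_; _<_; z≤n; s≤s)
open import Data.Nat.Properties
open import Data.Fin using (Fin; _↑ˡ_; _↑ʳ_; splitAt)
open import Data.Fin.Properties using (splitAt-↑ˡ; splitAt-↑ʳ)
open import Data.Vec.Functional using ([]; _∷_)
open import Data.Vec.Functional.Relation.Unary.All using (All)
open import Data.Vec.Functional.Relation.Unary.Any using (Any)
open import Data.Sum using (_⊎_; inj₁; inj₂; [_,_]′; swap)
open import Data.Product using (∃; ∃-syntax; _×_; _,_; proj₁; proj₂)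
open import Data.Empty using (⊥-elim)
open import Data.Bool using (Bool; true; false)
open import Relation.Nullary using (¬_)
open import Relation.Binary.PropositionalEquality

∃⊎∀ : ∀ {n} {P Q : Fin n → Set} → (∀ i → P i ⊎ Q i) → ∃ P ⊎ (∀ i → Q i)
∃⊎∀ {zero} h = inj₂ (λ ())
∃⊎∀ {suc n} h with h Fin.zero | ∃⊎∀ (λ i → h (Fin.suc i))
... | inj₁ p | _           = inj₁ (Fin.zero , p)
... | inj₂ _ | inj₁ (i , p) = inj₁ (Fin.suc i , p)
... | inj₂ q | inj₂ qs      = inj₂ (λ { Fin.zero → q ; (Fin.suc i) → qs i })

anyFin-≡true : ∀ {n} {f : Fin n → Bool} → Any (_≡ true) f → anyFin n f ≡ true
anyFin-≡true (Fin.zero , e) rewrite e = refl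
anyFin-≡true {f = f} (Fin.suc i , e) with f Fin.zero
... | true  = refl
... | false = anyFin-≡true (i , e)

anyFin-≡false : ∀ {n} {f : Fin n → Bool} → All (_≡ false) f → anyFin n f ≡ false
anyFin-≡false {zero} h = refl
anyFin-≡false {suc n} h rewrite h Fin.zero = anyFin-≡false (λ i → h (Fin.suc i))

maxFin-ub : ∀ n (f : Fin n → ℕ) i → f i ≤ maxFin n f
maxFin-ub (suc n) f Fin.zero    = m≤m⊔n _ _
maxFin-ub (suc n) f (Fin.suc i) = ≤-trans (maxFin-ub n (λ i → f (Fin.suc i)) i) (m≤n⊔m _ _)

maxFin-lub : ∀ n (f : Fin n → ℕ) {k} → (∀ i → f i ≤ k) → maxFin n f ≤ k
maxFin-lub zero    f h = z≤n
maxFin-lub (suc n) f h =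
  ⊔-lub (h Fin.zero) (maxFin-lub n (λ i → f (Fin.suc i)) (λ i → h (Fin.suc i)))

#left #right : Game → ℕ
#left  (mk m _ _ _) = m
#right (mk _ _ n _) = n

left : (G : Game) → Fin (#left G) → Game
left (mk _ GL _ _) = GL

right : (G : Game) → Fin (#right G) → Game
right (mk _ _ _ GR) = GR

infix 4 _∈ᴸ_ _∈ᴿ_
_∈ᴸ_ _∈ᴿ_ : Game → Game → Set
X ∈ᴸ G = ∃[ i ] left G i ≡ X
X ∈ᴿ G = ∃[ j ] right G j ≡ X

leftOption-+ʳ : ∀ G H {X} → X ∈ᴸ H → G +ᴳ X ∈ᴸ G +ᴳ H
leftOption-+ʳ (mk m _ _ _) (mk m′ _ _ _) (i , refl) =
  m ↑ʳ i , cong [ _ , _ ]′ (splitAt-↑ʳ m m′ i)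

rightOption-+ˡ : ∀ G H {X} → X ∈ᴿ G → X +ᴳ H ∈ᴿ G +ᴳ H
rightOption-+ˡ (mk _ _ n _) (mk _ _ n′ _) (j , refl) =
  j ↑ˡ n′ , cong [ _ , _ ]′ (splitAt-↑ˡ n j n′)

rightOption-+ʳ : ∀ G H {X} → X ∈ᴿ H → G +ᴳ X ∈ᴿ G +ᴳ H
rightOption-+ʳ (mk _ _ n _) (mk _ _ n′ _) (j , refl) =
  n ↑ʳ j , cong [ _ , _ ]′ (splitAt-↑ʳ n n′ j)

All-left-leftDeadEnd-+ : ∀ G H {P : Game → Set} → IsLeftDeadEnd G →
  All (λ X → P (G +ᴳ X)) (left H) → All P (left (G +ᴳ H))
All-left-leftDeadEnd-+ (mk zero _ _ _) (mk _ _ _ _) _ hH = hH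

All-right-+ : ∀ G H {P : Game → Set} →
  All (λ X → P (X +ᴳ H)) (right G) → All (λ X → P (G +ᴳ X)) (right H) →
  All P (right (G +ᴳ H))
All-right-+ (mk _ _ n _) (mk _ _ _ _) hG hH k with splitAt n k
... | inj₁ j = hG j
... | inj₂ j = hH j

oL≡𝓛 : ∀ G {X} → X ∈ᴸ G → oR X ≡ 𝓛 → oL G ≡ 𝓛
oL≡𝓛 (mk (suc m) GL _ _) (i , refl) e
  rewrite anyFin-≡true {f = λ i → isL (oR (GL i))} (i , cong isL e) = refl

oL≡𝓡 : ∀ G {X} → X ∈ᴸ G → All (λ X → oR X ≡ 𝓡) (left G) → oL G ≡ 𝓡
oL≡𝓡 (mk (suc m) GL _ _) _ h
  rewrite anyFin-≡false {f = λ i → isL (oR (GL i))} (λ i → cong isL (h i)) = refl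

oR≡𝓡 : ∀ G {X} → X ∈ᴿ G → oL X ≡ 𝓡 → oR G ≡ 𝓡
oR≡𝓡 (mk _ _ (suc n) GR) (j , refl) e
  rewrite anyFin-≡true {f = λ j → isR (oL (GR j))} (j , cong isR e) = refl

oR≡𝓛 : ∀ G {X} → X ∈ᴿ G → All (λ X → oL X ≡ 𝓛) (right G) → oR G ≡ 𝓛
oR≡𝓛 (mk _ _ (suc n) GR) _ h
  rewrite anyFin-≡false {f = λ j → isR (oL (GR j))} (λ j → cong isR (h j)) = refl

All-left-leftDeadEnd : ∀ G {P : Game → Set} → IsLeftDeadEnd G → All P (left G)
All-left-leftDeadEnd (mk zero _ _ _) _ ()

leftDeadEnd-+ : ∀ G H → IsLeftDeadEnd G → IsLeftDeadEnd H → IsLeftDeadEnd (G +ᴳ H)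
leftDeadEnd-+ G@(mk zero _ _ GR) H@(mk zero _ _ HR) dG dH = All-right-+ G H {IsLeftDeadEnd}
  (λ j → leftDeadEnd-+ (GR j) H (dG j) dH) (λ j → leftDeadEnd-+ G (HR j) dG (dH j))

b̃ : Game → ℕ
b̃ = formalBirthday

formalBirthday-rightOption : ∀ G {X} → X ∈ᴿ G → b̃ X < b̃ G
formalBirthday-rightOption (mk zero _ (suc n) GR) (j , refl) =
  s≤s (maxFin-ub (suc n) (λ j → b̃ (GR j)) j)
formalBirthday-rightOption (mk (suc m) _ n GR) (j , refl) =
  s≤s (≤-trans (maxFin-ub n (λ j → b̃ (GR j)) j) (m≤n⊔m _ _))

formalBirthday-lub : ∀ G {k} → IsLeftDeadEnd G → All (λ X → b̃ X < k) (right G) → b̃ G ≤ k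
formalBirthday-lub (mk zero _ zero _)             _ _ = z≤n
formalBirthday-lub (mk zero _ (suc n) _)  {zero}  _ h = ⊥-elim (n≮0 (h Fin.zero))
formalBirthday-lub (mk zero _ (suc n) GR) {suc k} _ h =
  s≤s (maxFin-lub (suc n) (λ j → b̃ (GR j)) (λ j → ≤-pred (h j)))

formalBirthday-+-fromOptions : ∀ G H → IsLeftDeadEnd G → IsLeftDeadEnd H →
  All (λ X → b̃ (X +ᴳ H) ≡ b̃ X + b̃ H) (right G) →
  All (λ X → b̃ (G +ᴳ X) ≡ b̃ G + b̃ X) (right H) →
  b̃ (G +ᴳ H) ≡ b̃ G + b̃ H
formalBirthday-+-fromOptions G H dG dH ihG ihH = ≤-antisym upper lower
  where
  open ≤-Reasoning

  optionOf-G+H< : ∀ {X} → X ∈ᴿ G +ᴳ H → b̃ X < b̃ (G +ᴳ H)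
  optionOf-G+H< = formalBirthday-rightOption (G +ᴳ H)

  upper : b̃ (G +ᴳ H) ≤ b̃ G + b̃ H
  upper = formalBirthday-lub (G +ᴳ H) (leftDeadEnd-+ G H dG dH)
    (All-right-+ G H {λ X → b̃ X < b̃ G + b̃ H}
      (λ j → subst (_< b̃ G + b̃ H) (sym (ihG j))
               (+-monoˡ-< (b̃ H) (formalBirthday-rightOption G (j , refl))))
      (λ j → subst (_< b̃ G + b̃ H) (sym (ihH j))
               (+-monoʳ-< (b̃ G) (formalBirthday-rightOption H (j , refl)))))

  H≤G+H : b̃ H ≤ b̃ (G +ᴳ H)
  H≤G+H = formalBirthday-lub H dH λ j → begin-strict
    b̃ (right H j)        ≤⟨ m≤n+m (b̃ (right H j)) (b̃ G) ⟩
    b̃ G + b̃ (right H j)  ≡⟨ ihH j ⟨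
    b̃ (G +ᴳ right H j)   <⟨ optionOf-G+H< (rightOption-+ʳ G H (j , refl)) ⟩
    b̃ (G +ᴳ H)           ∎

  -- Bounding b̃ G by b̃ (G + H) ∸ b̃ H avoids a case split on whether G has Right options.
  lower : b̃ G + b̃ H ≤ b̃ (G +ᴳ H)
  lower = m≤o∸n⇒m+n≤o (b̃ G) H≤G+H (formalBirthday-lub G dG λ j →
    m+n≤o⇒m≤o∸n (suc (b̃ (right G j))) (begin-strict
      b̃ (right G j) + b̃ H   ≡⟨ ihG j ⟨
      b̃ (right G j +ᴳ H)    <⟨ optionOf-G+H< (rightOption-+ˡ G H (j , refl)) ⟩
      b̃ (G +ᴳ H)            ∎))

formalBirthday-+ : ∀ G H → IsLeftDeadEnd G → IsLeftDeadEnd H → b̃ (G +ᴳ H) ≡ b̃ G + b̃ H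
formalBirthday-+ G@(mk zero _ _ GR) H@(mk zero _ _ HR) dG dH =
  formalBirthday-+-fromOptions G H dG dH
    (λ j → formalBirthday-+ (GR j) H (dG j) dH) (λ j → formalBirthday-+ G (HR j) dG (dH j))

integer : ℕ → Game
integer zero    = mk 0 [] 0 []
integer (suc n) = mk 1 (λ _ → integer n) 0 []

oR-+integer : ∀ B → IsLeftDeadEnd B → ∀ n → b̃ B ≤ n → oR (B +ᴳ integer n) ≡ 𝓡
oR-+integer (mk zero _ zero _) _ zero    _ = refl
oR-+integer (mk zero _ zero _) _ (suc n) _ = refl
oR-+integer B@(mk zero _ (suc _) BR) dB (suc n) B≤1+n =
  oR≡𝓡 (B +ᴳ 1+n) (rightOption-+ˡ B 1+n (Fin.zero , refl))
    (oL≡𝓡 (B′ +ᴳ 1+n) (leftOption-+ʳ B′ 1+n (Fin.zero , refl))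
      (All-left-leftDeadEnd-+ B′ 1+n {λ X → oR X ≡ 𝓡} (dB Fin.zero)
        (λ _ → oR-+integer B′ (dB Fin.zero) n
          (≤-pred (<-≤-trans (formalBirthday-rightOption B (Fin.zero , refl)) B≤1+n)))))
  where
  B′ 1+n : Game
  B′  = BR Fin.zero
  1+n = integer (suc n)

Distinguishable : Game → Game → Set
Distinguishable A B = ∃[ Z ] oR (A +ᴳ Z) ≡ 𝓛 × oR (B +ᴳ Z) ≡ 𝓡

distinguishable⇒≢ᴹ : ∀ A B → Distinguishable A B → ¬ A ≡ᴹ B
distinguishable⇒≢ᴹ A B (Z , A+Z≡𝓛 , B+Z≡𝓡) A≡B
  with trans (sym A+Z≡𝓛) (trans (cong proj₂ (A≡B Z)) B+Z≡𝓡)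
... | ()

distinguishable-fromRightOption : ∀ A B → IsLeftDeadEnd A → IsLeftDeadEnd B →
  (j : Fin (#right B)) →
  All (λ A′ → Distinguishable A′ (right B j)) (right A) → Distinguishable A B
distinguishable-fromRightOption A@(mk zero _ nA AR) B@(mk zero _ _ BR) dA dB j dist =
  Y , oR[A+Y]≡𝓛 , oR[B+Y]≡𝓡
  where
  Y : Game
  Y = mk (suc nA) (integer (b̃ (BR j)) ∷ λ i → proj₁ (dist i)) 1 (λ _ → integer 0)

  oR[A+Y]≡𝓛 : oR (A +ᴳ Y) ≡ 𝓛
  oR[A+Y]≡𝓛 = oR≡𝓛 (A +ᴳ Y) (rightOption-+ʳ A Y (Fin.zero , refl))
    (All-right-+ A Y {λ X → oL X ≡ 𝓛}
      (λ i → oL≡𝓛 (AR i +ᴳ Y) (leftOption-+ʳ (AR i) Y (Fin.suc i , refl))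
               (proj₁ (proj₂ (dist i))))
      (λ _ → refl))

  oR[B+Y]≡𝓡 : oR (B +ᴳ Y) ≡ 𝓡
  oR[B+Y]≡𝓡 = oR≡𝓡 (B +ᴳ Y) (rightOption-+ˡ B Y (j , refl))
    (oL≡𝓡 (BR j +ᴳ Y) (leftOption-+ʳ (BR j) Y (Fin.zero , refl))
      (All-left-leftDeadEnd-+ (BR j) Y {λ X → oR X ≡ 𝓡} (dB j)
        λ { Fin.zero    → oR-+integer (BR j) (dB j) (b̃ (BR j)) ≤-refl
          ; (Fin.suc i) → proj₂ (proj₂ (dist i)) }))

formalBirthday-≤⊎distinguishable : ∀ A B → IsLeftDeadEnd A → IsLeftDeadEnd B →
  b̃ B ≤ b̃ A ⊎ Distinguishable A B
formalBirthday-≤⊎distinguishable A@(mk zero _ _ AR) B@(mk zero _ _ BR) dA dB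
  with ∃⊎∀ (λ j → swap (∃⊎∀ (λ i →
         formalBirthday-≤⊎distinguishable (AR i) (BR j) (dA i) (dB j))))
... | inj₁ (j , dist) = inj₂ (distinguishable-fromRightOption A B dA dB j dist)
... | inj₂ below      = inj₁ (formalBirthday-lub B dB λ j →
        let (i , BRj≤ARi) = below j
        in ≤-<-trans BRj≤ARi (formalBirthday-rightOption A (i , refl)))

≡ᴹ⇒formalBirthday-≤ : ∀ A B → IsLeftDeadEnd A → IsLeftDeadEnd B → A ≡ᴹ B → b̃ B ≤ b̃ A
≡ᴹ⇒formalBirthday-≤ A B dA dB A≡B with formalBirthday-≤⊎distinguishable A B dA dB
... | inj₁ B≤A  = B≤A
... | inj₂ dist = ⊥-elim (distinguishable⇒≢ᴹ A B dist A≡B)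

isBirthday-formalBirthday : ∀ G → IsLeftDeadEnd G → IsBirthday G (b̃ G)
isBirthday-formalBirthday G dG =
  (G , dG , (λ _ → refl) , refl) , λ K dK K≡G → ≡ᴹ⇒formalBirthday-≤ K G dK dG K≡G

isBirthday-unique : ∀ G {a b} → IsBirthday G a → IsBirthday G b → a ≡ b
isBirthday-unique _ ((K , dK , K≡G , b̃K≡a) , a-min) ((L , dL , L≡G , b̃L≡b) , b-min) =
  ≤-antisym (subst (_ ≤_) b̃L≡b (a-min L dL L≡G)) (subst (_ ≤_) b̃K≡a (b-min K dK K≡G))

proposition3p8 : (G H : Game) → IsLeftDeadEnd G → IsLeftDeadEnd H →
    (a b : ℕ) → IsBirthday G a → IsBirthday H b → IsBirthday (G +ᴳ H) (a + b)
proposition3p8 G H dG dH a b bG bH =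
  subst (IsBirthday (G +ᴳ H)) b̃[G+H]≡a+b
    (isBirthday-formalBirthday (G +ᴳ H) (leftDeadEnd-+ G H dG dH))
  where
  open ≡-Reasoning
  b̃[G+H]≡a+b : b̃ (G +ᴳ H) ≡ a + b
  b̃[G+H]≡a+b = begin
    b̃ (G +ᴳ H)  ≡⟨ formalBirthday-+ G H dG dH ⟩
    b̃ G + b̃ H   ≡⟨ cong₂ _+_ (isBirthday-unique G (isBirthday-formalBirthday G dG) bG)
                             (isBirthday-unique H (isBirthday-formalBirthday H dH) bH) ⟩
    a + b       ∎
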